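{- There exists an acyclic system of permutations of $[5]=\{1,\dots,5\}$ on the complete graph $K_4=\operatorname{graph}(\Delta_3)$ that is not the system of permutations induced by any triangulation of $\Delta_4\times\Delta_3$. Equivalently, there is a triangulation of the $3$-skeleton of $\Delta_4\times\Delta_3$ (using only its vertices) that cannot be extended to a triangulation of $\Delta_4\times\Delta_3$.
   Context: Triangulations use no vertices other than those of the polytope. Triangulations of $\Delta_{n-1}\times\Delta_1$ (with $\Delta_1$ having vertices $A,B$ and $\Delta_{n-1}$ having vertices $[n]$) are in bijection with permutations (orderings) of $[n]$: an edge $ij$ is ordered from $i$ to $j$ when the square $\{A,B\}\times\{i,j\}$ is triangulated with diagonal $(A,i)(B,j)$. A system of permutations of $[n]$ on a graph $G$ assigns to each edge of $G$ a permutation of $[n]$ written along the edge (reversing the edge's orientation reverses the permutation). A triangulation $T$ of $\Delta_{n-1}\times\Delta_{d-1}$ induces a system of permutations of $[n]$ on $\operatorname{graph}(\Delta_{d-1})=K_d$ by writing along each edge $e$ the permutation corresponding to the restriction of $T$ to $\Delta_{n-1}\times e$. A system of permutations is acyclic if, for every two symbols $i,j\in[n]$, orienting each edge of $G$ in the direction in which $i$ comes before $j$ yields an acyclic directed graph. -}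

module Defs where

open import Data.Nat using (ℕ; zero; suc)
open import Data.Fin using (Fin; zero; suc; _<_)
open import Data.Fin.Permutation using (Permutation′; _⟨$⟩ʳ_)
open import Data.Bool using (Bool; true; false; _∧_)
open import Data.Rational using (ℚ; 0ℚ; 1ℚ; _+_; _≤_)
open import Data.List using (List)
open import Data.List.Membership.Propositional using (_∈_)
open import Data.Product using (Σ; ∃; ∃-syntax; _×_; _,_)
open import Relation.Binary.PropositionalEquality using (_≡_; _≢_)
open import Relation.Binary.Construct.Closure.Transitive using (TransClosure)
open import Relation.Nullary using (¬_)
open import Function.Bundles using (_⇔_)

-- A permutation π of [n] is read as "symbol i sits at position π i".
-- i comes before j in π:
Before : ∀ {n} → Permutation′ n → Fin n → Fin n → Set
Before π i j = (π ⟨$⟩ʳ i) < (π ⟨$⟩ʳ j)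

record System (n d : ℕ) : Set where
  field
    perm : Fin d → Fin d → Permutation′ n
    reversal : ∀ a b → a ≢ b → ∀ i j →
               Before (perm a b) i j ⇔ Before (perm b a) j i
open System public

Arc : ∀ {n d} → System n d → Fin n → Fin n → Fin d → Fin d → Set
Arc P i j a b = (a ≢ b) × Before (perm P a b) i j

Acyclic : ∀ {n d} → System n d → Set
Acyclic {n} {d} P = ∀ (i j : Fin n) → i ≢ j → ∀ (a : Fin d) →
  ¬ TransClosure (Arc P i j) a a

sumFin : ∀ k → (Fin k → ℚ) → ℚ
sumFin zero f = 0ℚ
sumFin (suc k) f = f zero + sumFin k (λ x → f (suc x))

-- Vertices of Δ_{n-1} × Δ_{d-1} are pairs (i , a) ∈ [n] × [d]; the vertex
-- (i , a) is the point e_i ⊕ f_a ∈ ℚ^n ⊕ ℚ^d.  A set of vertices: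
VSet : ℕ → ℕ → Set
VSet n d = Fin n → Fin d → Bool

-- Point (x , y) ∈ ℚ^n × ℚ^d lies in the convex hull of the vertex set S:
-- there are coefficients λ ≥ 0 supported on S, summing to 1, with
-- Σ λ_{ia} (e_i ⊕ f_a) = x ⊕ y.
InConv : ∀ {n d} → VSet n d → (Fin n → ℚ) → (Fin d → ℚ) → Set
InConv {n} {d} S x y = Σ (Fin n → Fin d → ℚ) λ l →
    (∀ i a → 0ℚ ≤ l i a)
  × (∀ i a → S i a ≡ false → l i a ≡ 0ℚ)
  × (sumFin n (λ i → sumFin d (λ a → l i a)) ≡ 1ℚ)
  × (∀ i → sumFin d (λ a → l i a) ≡ x i)
  × (∀ a → sumFin n (λ i → l i a) ≡ y a)

InPolytope : ∀ {n d} → (Fin n → ℚ) → (Fin d → ℚ) → Set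
InPolytope {n} {d} x y =
    (∀ i → 0ℚ ≤ x i) × sumFin n x ≡ 1ℚ
  × (∀ a → 0ℚ ≤ y a) × sumFin d y ≡ 1ℚ

AffInd : ∀ {n d} → VSet n d → Set
AffInd {n} {d} S = ∀ (μ : Fin n → Fin d → ℚ) →
    (∀ i a → S i a ≡ false → μ i a ≡ 0ℚ)
  → sumFin n (λ i → sumFin d (λ a → μ i a)) ≡ 0ℚ
  → (∀ i → sumFin d (λ a → μ i a) ≡ 0ℚ)
  → (∀ a → sumFin n (λ i → μ i a) ≡ 0ℚ)
  → ∀ i a → μ i a ≡ 0ℚ

_∩ᵥ_ : ∀ {n d} → VSet n d → VSet n d → VSet n d
(S ∩ᵥ S') i a = S i a ∧ S' i a

-- Rational points suffice since all
-- the sets involved are rational polytopes.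
IsTriangulation : ∀ {n d} → List (VSet n d) → Set
IsTriangulation {n} {d} T =
    (∀ S → S ∈ T → AffInd S)
  × (∀ x y → InPolytope x y → ∃[ S ] (S ∈ T × InConv S x y))
  × (∀ S S' → S ∈ T → S' ∈ T → ∀ x y →
       InConv S x y → InConv S' x y → InConv (S ∩ᵥ S') x y)

-- The square {a,b} × {i,j} is triangulated (by T) with the diagonal
-- (a,i)(b,j): some simplex of T contains both endpoints.
UsesDiagonal : ∀ {n d} → List (VSet n d) → Fin d → Fin n → Fin d → Fin n → Set
UsesDiagonal T a i b j = ∃[ S ] (S ∈ T × S i a ≡ true × S j b ≡ true)

-- T induces the system P: along each oriented edge a → b of K_d, the
-- permutation is the one of the restriction of T to Δ_{n-1} × {a,b}
-- (with A = a, B = b): i before j iff the diagonal (A,i)(B,j) is used.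
Induces : ∀ {n d} → List (VSet n d) → System n d → Set
Induces {n} {d} T P = ∀ (a b : Fin d) → a ≢ b → ∀ (i j : Fin n) → i ≢ j →
  Before (perm P a b) i j ⇔ UsesDiagonal T a i b j

module Submission where

-- Acyclicity is a finite check: in-degrees give a topological order of every
-- tournament Arc P i j.  For non-extendability, take a triangulation inducing
-- the system and the simplex covering the point p.  Its vertices are forced one
-- at a time: (i , a) is present when row i (or column a) of the barycentric
-- coordinates cannot reach p's coordinate without it, and each present vertex
-- excludes the vertices it would form a wrongly oriented diagonal with.  This
-- places the triangle (0,3),(1,0),(2,1) in one simplex and, via q, the triangle
-- (0,0),(1,1),(2,3) in another.  Both triangles contain the same centre point in
-- their relative interiors, but barycentric coordinates of a point must agree
-- across the simplices of a triangulation.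

open import Defs
open import Data.Product using (Σ; ∃-syntax; _×_)
open import Data.List using (List)
open import Relation.Nullary using (¬_)

open import Data.Product using (_,_; proj₁)
open import Data.Product.Properties using (≡-dec)
open import Data.Bool using (true; false; if_then_else_)
open import Data.Nat as ℕ using (ℕ; zero; suc)
import Data.Nat.Properties as ℕₚ
open import Data.Integer using (+_)
open import Data.Rational using (ℚ; 0ℚ; 1ℚ; _+_; _-_; _≤_; _<_; _/_)
import Data.Rational.Properties as ℚₚ
open import Data.Rational.Solver using (module +-*-Solver)
open import Algebra.Properties.Group ℚₚ.+-0-group using (x∙y⁻¹≈ε⇒x≈y)
open import Data.Fin as Fin using (Fin; zero; suc; opposite)
import Data.Fin.Properties as Finₚ
open import Data.Fin.Patterns using (0F; 1F; 2F; 3F; 4F)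
open import Data.Fin.Permutation using (Permutation′; permutation; _⟨$⟩ʳ_; _∘ₚ_; reverse; id)
open import Data.List using ([]; _∷_; length; filter; allFin)
open import Data.List.Relation.Unary.All as All using (All; []; _∷_)
open import Data.List.Relation.Unary.Any using (any?)
open import Data.List.Membership.Propositional using (_∈_)
open import Data.Vec using (Vec; []; _∷_; lookup)
open import Function using (_∘_)
open import Function.Bundles using (_⇔_; mk⇔; Equivalence)
import Function.Properties.Equivalence as ⇔
open import Relation.Binary.PropositionalEquality
open import Relation.Binary.Definitions using (tri<; tri≈; tri>)
open import Relation.Binary.Construct.Closure.Transitive using (TransClosure; [_]; _∷_)
open import Relation.Nullary using (Dec; does; yes; no; ¬?; contradiction)
open import Relation.Nullary.Decidable
  using (True; False; toWitness; toWitnessFalse; from-yes; _×-dec_; _→-dec_)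

sumFin-zero : ∀ k {f : Fin k → ℚ} → (∀ b → f b ≡ 0ℚ) → sumFin k f ≡ 0ℚ
sumFin-zero zero    f≡0 = refl
sumFin-zero (suc k) f≡0 = cong₂ _+_ (f≡0 zero) (sumFin-zero k (f≡0 ∘ suc))

sumFin-mono-≤ : ∀ k {f g : Fin k → ℚ} → (∀ b → f b ≤ g b) → sumFin k f ≤ sumFin k g
sumFin-mono-≤ zero    f≤g = ℚₚ.≤-refl
sumFin-mono-≤ (suc k) f≤g = ℚₚ.+-mono-≤ (f≤g zero) (sumFin-mono-≤ k (f≤g ∘ suc))

sumFin-nonneg : ∀ k {f : Fin k → ℚ} → (∀ b → 0ℚ ≤ f b) → 0ℚ ≤ sumFin k f
sumFin-nonneg k {f} f≥0 =
  subst (_≤ sumFin k f) (sumFin-zero k {λ _ → 0ℚ} (λ _ → refl)) (sumFin-mono-≤ k f≥0)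

term≤sumFin : ∀ k {f : Fin k → ℚ} → (∀ b → 0ℚ ≤ f b) → ∀ b → f b ≤ sumFin k f
term≤sumFin (suc k) {f} f≥0 zero = begin
  f zero               ≡⟨ ℚₚ.+-identityʳ (f zero) ⟨
  f zero + 0ℚ          ≤⟨ ℚₚ.+-monoʳ-≤ (f zero) (sumFin-nonneg k (f≥0 ∘ suc)) ⟩
  sumFin (suc k) f     ∎
  where open ℚₚ.≤-Reasoning
term≤sumFin (suc k) {f} f≥0 (suc b) = begin
  f (suc b)                   ≡⟨ ℚₚ.+-identityˡ (f (suc b)) ⟨
  0ℚ + f (suc b)              ≤⟨ ℚₚ.+-mono-≤ (f≥0 zero) (term≤sumFin k (f≥0 ∘ suc) b) ⟩
  sumFin (suc k) f            ∎
  where open ℚₚ.≤-Reasoning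

sumFin-sub : ∀ k (f g : Fin k → ℚ) → sumFin k (λ b → f b - g b) ≡ sumFin k f - sumFin k g
sumFin-sub zero    f g = refl
sumFin-sub (suc k) f g rewrite sumFin-sub k (f ∘ suc) (g ∘ suc) =
  solve 4 (λ a b c d → (a :- b) :+ (c :- d) := (a :+ c) :- (b :+ d)) refl
    (f zero) (g zero) (sumFin k (f ∘ suc)) (sumFin k (g ∘ suc))
  where open +-*-Solver

module _ {n d : ℕ} where

  _⊆ᵥ_ : VSet n d → VSet n d → Set
  S ⊆ᵥ S′ = ∀ i a → S i a ≡ true → S′ i a ≡ true

  ∩ᵥ-⊆ˡ : (S S′ : VSet n d) → (S ∩ᵥ S′) ⊆ᵥ S
  ∩ᵥ-⊆ˡ S S′ i a with S i a
  ... | true  = λ _ → refl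
  ... | false = λ ()

  ∩ᵥ-⊆ʳ : (S S′ : VSet n d) → (S ∩ᵥ S′) ⊆ᵥ S′
  ∩ᵥ-⊆ʳ S S′ i a with S i a
  ... | true  = λ S′ia → S′ia
  ... | false = λ ()

  coefficients : ∀ {S x y} → InConv {n} {d} S x y → Fin n → Fin d → ℚ
  coefficients = proj₁

  InConv-mono : ∀ {S S′ x y} → S ⊆ᵥ S′ → InConv S x y → InConv S′ x y
  InConv-mono {S} {S′} S⊆S′ (l , l≥0 , supp , total , rows , cols) =
    l , l≥0 , supp′ , total , rows , cols
    where
    supp′ : ∀ i a → S′ i a ≡ false → l i a ≡ 0ℚ
    supp′ i a S′ia with S i a in Sia
    ... | false = supp i a Sia
    ... | true  = contradiction (trans (sym (S⊆S′ i a Sia)) S′ia) λ ()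

  -- Two representations of the same point differ by an affine dependence.
  InConv-unique : ∀ {S x y} → AffInd S → (r r′ : InConv S x y) →
                  ∀ i a → coefficients r i a ≡ coefficients r′ i a
  InConv-unique {S} {x} {y} indep (l , _ , supp , _ , rows , cols) (l′ , _ , supp′ , _ , rows′ , cols′) i a =
    x∙y⁻¹≈ε⇒x≈y (l i a) (l′ i a) (indep δ suppδ totalδ rowsδ colsδ i a)
    where
    δ : Fin n → Fin d → ℚ
    δ i a = l i a - l′ i a
    suppδ : ∀ i a → S i a ≡ false → δ i a ≡ 0ℚ
    suppδ i a Sia rewrite supp i a Sia | supp′ i a Sia = refl
    rowsδ : ∀ i → sumFin d (δ i) ≡ 0ℚ
    rowsδ i = begin
      sumFin d (δ i)                    ≡⟨ sumFin-sub d (l i) (l′ i) ⟩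
      sumFin d (l i) - sumFin d (l′ i)  ≡⟨ cong₂ _-_ (rows i) (rows′ i) ⟩
      x i - x i                         ≡⟨ ℚₚ.+-inverseʳ (x i) ⟩
      0ℚ                                ∎
      where open ≡-Reasoning
    colsδ : ∀ a → sumFin n (λ i → δ i a) ≡ 0ℚ
    colsδ a = begin
      sumFin n (λ i → δ i a)                            ≡⟨ sumFin-sub n (λ i → l i a) (λ i → l′ i a) ⟩
      sumFin n (λ i → l i a) - sumFin n (λ i → l′ i a)  ≡⟨ cong₂ _-_ (cols a) (cols′ a) ⟩
      y a - y a                                         ≡⟨ ℚₚ.+-inverseʳ (y a) ⟩
      0ℚ                                                ∎
      where open ≡-Reasoning
    totalδ : sumFin n (λ i → sumFin d (δ i)) ≡ 0ℚ
    totalδ = sumFin-zero n rowsδ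

  vertices : List (Fin n × Fin d) → VSet n d
  vertices vs i a = does (any? (≡-dec Finₚ._≟_ Finₚ._≟_ (i , a)) vs)

  vertices-⊆ : ∀ {S vs} → All (λ (i , a) → S i a ≡ true) vs → vertices vs ⊆ᵥ S
  vertices-⊆ {vs = vs} onS i a with any? (≡-dec Finₚ._≟_ Finₚ._≟_ (i , a)) vs
  ... | yes v∈vs = λ _ → All.lookup onS v∈vs
  ... | no  _    = λ ()

  InPolytope? : (x : Fin n → ℚ) (y : Fin d → ℚ) → Dec (InPolytope x y)
  InPolytope? x y = Finₚ.all? (λ i → 0ℚ ℚₚ.≤? x i) ×-dec sumFin n x ℚₚ.≟ 1ℚ
               ×-dec Finₚ.all? (λ a → 0ℚ ℚₚ.≤? y a) ×-dec sumFin d y ℚₚ.≟ 1ℚ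

  triangulation-coefficients-agree :
    ∀ {T S S′ x y} → IsTriangulation T → S ∈ T → S′ ∈ T →
    (r : InConv S x y) (r′ : InConv S′ x y) →
    ∀ i a → coefficients r i a ≡ coefficients r′ i a
  triangulation-coefficients-agree {S = S} {S′} (indep , _ , proper) S∈T S′∈T r r′ i a =
    trans (sym (InConv-unique (indep S S∈T) (InConv-mono (∩ᵥ-⊆ˡ S S′) μ) r i a))
          (InConv-unique (indep S′ S′∈T) (InConv-mono (∩ᵥ-⊆ʳ S S′) μ) r′ i a)
    where
    μ = proper S S′ S∈T S′∈T _ _ r r′

vanishOn : ∀ {k} → List (Fin k) → (Fin k → ℚ) → Fin k → ℚ
vanishOn zs f b with any? (b Finₚ.≟_) zs
... | yes _ = 0ℚ
... | no  _ = f b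

sumFin-≤-vanishOn : ∀ k {f g : Fin k → ℚ} zs → (∀ b → f b ≤ g b) →
                    All (λ b → f b ≡ 0ℚ) zs → sumFin k f ≤ sumFin k (vanishOn zs g)
sumFin-≤-vanishOn k {f} {g} zs f≤g f≡0 = sumFin-mono-≤ k bound
  where
  bound : ∀ b → f b ≤ vanishOn zs g b
  bound b with any? (b Finₚ.≟_) zs
  ... | yes b∈zs = ℚₚ.≤-reflexive (All.lookup f≡0 b∈zs)
  ... | no  _    = f≤g b

module _ {n d : ℕ} {S : VSet n d} {x : Fin n → ℚ} {y : Fin d → ℚ} where
  open ℚₚ.≤-Reasoning

  forcedInRow : InConv S x y → ∀ {i a} {zs : List (Fin d)} → All (λ b → S i b ≡ false) zs →
                {True (sumFin d (vanishOn (a ∷ zs) y) ℚₚ.<? x i)} → S i a ≡ true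
  forcedInRow (l , l≥0 , supp , _ , rows , cols) {i} {a} {zs} excluded {bound} with S i a in Sia
  ... | true  = refl
  ... | false = contradiction x<x (ℚₚ.<-irrefl refl)
    where
    entry≤column : ∀ b → l i b ≤ y b
    entry≤column b = subst (l i b ≤_) (cols b) (term≤sumFin n (λ j → l≥0 j b) i)
    x<x : x i < x i
    x<x = begin-strict
      x i                             ≡⟨ rows i ⟨
      sumFin d (l i)                  ≤⟨ sumFin-≤-vanishOn d (a ∷ zs) entry≤column
                                           (All.map (supp i _) (Sia ∷ excluded)) ⟩
      sumFin d (vanishOn (a ∷ zs) y)  <⟨ toWitness bound ⟩
      x i                             ∎

  forcedInColumn : InConv S x y → ∀ {i a} {zs : List (Fin n)} → All (λ j → S j a ≡ false) zs →
                   {True (sumFin n (vanishOn (i ∷ zs) x) ℚₚ.<? y a)} → S i a ≡ true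
  forcedInColumn (l , l≥0 , supp , _ , rows , cols) {i} {a} {zs} excluded {bound} with S i a in Sia
  ... | true  = refl
  ... | false = contradiction y<y (ℚₚ.<-irrefl refl)
    where
    entry≤row : ∀ j → l j a ≤ x j
    entry≤row j = subst (l j a ≤_) (rows j) (term≤sumFin d (l≥0 j) a)
    y<y : y a < y a
    y<y = begin-strict
      y a                             ≡⟨ cols a ⟨
      sumFin n (λ j → l j a)          ≤⟨ sumFin-≤-vanishOn n (i ∷ zs) entry≤row
                                           (All.map (λ {j} → supp j a) (Sia ∷ excluded)) ⟩
      sumFin n (vanishOn (i ∷ zs) x)  <⟨ toWitness bound ⟩
      y a                             ∎

Before? : ∀ {n} (π : Permutation′ n) i j → Dec (Before π i j)
Before? π i j = (π ⟨$⟩ʳ i) Finₚ.<? (π ⟨$⟩ʳ j)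

induced-exclusion : ∀ {n d} {T : List (VSet n d)} {P : System n d} {S i a j b} →
                    Induces T P → S ∈ T → S i a ≡ true → a ≢ b → i ≢ j →
                    ¬ Before (perm P a b) i j → S j b ≡ false
induced-exclusion {S = S} {j = j} {b = b} induces S∈T Sia a≢b i≢j ¬before with S j b in Sjb
... | false = refl
... | true  = contradiction (Equivalence.from (induces _ _ a≢b _ _ i≢j) (S , S∈T , Sia , Sjb)) ¬before

opposite-< : ∀ {n} {i j : Fin n} → i Fin.< j → opposite j Fin.< opposite i
opposite-< {i = i} {j} i<j rewrite Finₚ.opposite-prop i | Finₚ.opposite-prop j =
  ℕₚ.∸-monoʳ-< (ℕ.s≤s i<j) (Finₚ.toℕ<n j)

Before-reverse : ∀ {n} (π : Permutation′ n) i j → Before π i j ⇔ Before (π ∘ₚ reverse) j i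
Before-reverse π i j = mk⇔ opposite-< (subst₂ Fin._<_ (Finₚ.opposite-involutive (π ⟨$⟩ʳ i))
                                                     (Finₚ.opposite-involutive (π ⟨$⟩ʳ j))
                                        ∘ opposite-<)

orient : ∀ {n d} → (Fin d → Fin d → Permutation′ n) → Fin d → Fin d → Permutation′ n
orient σ a b with Finₚ.<-cmp a b
... | tri< _ _ _ = σ a b
... | tri≈ _ _ _ = id
... | tri> _ _ _ = σ b a ∘ₚ reverse

orient-reversal : ∀ {n d} σ (a b : Fin d) → a ≢ b → ∀ (i j : Fin n) →
                  Before (orient σ a b) i j ⇔ Before (orient σ b a) j i
orient-reversal σ a b a≢b i j with Finₚ.<-cmp a b | Finₚ.<-cmp b a
... | tri< _ _ _   | tri> _ _ _    = Before-reverse (σ a b) i j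
... | tri> _ _ _   | tri< _ _ _    = ⇔.sym (Before-reverse (σ b a) j i)
... | tri≈ _ a≡b _ | _             = contradiction a≡b a≢b
... | tri< _ _ _   | tri≈ _ b≡a _  = contradiction (sym b≡a) a≢b
... | tri> _ _ _   | tri≈ _ b≡a _  = contradiction (sym b≡a) a≢b
... | tri< a<b _ _ | tri< _ _ a≮b  = contradiction a<b a≮b
... | tri> _ _ b<a | tri> b≮a _ _  = contradiction b<a b≮a

-- Only the values σ a b with a < b are used.
orientedSystem : ∀ {n d} → (Fin d → Fin d → Permutation′ n) → System n d
orientedSystem σ = record { perm = orient σ ; reversal = orient-reversal σ }

TransClosure-rank-< : ∀ {A : Set} {R : A → A → Set} (rank : A → ℕ) →
                      (∀ {a b} → R a b → rank a ℕ.< rank b) →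
                      ∀ {a b} → TransClosure R a b → rank a ℕ.< rank b
TransClosure-rank-< rank increasing [ r ]    = increasing r
TransClosure-rank-< rank increasing (r ∷ rs) =
  ℕₚ.<-trans (increasing r) (TransClosure-rank-< rank increasing rs)

acyclic-by-rank : ∀ {n d} (P : System n d) (rank : Fin n → Fin n → Fin d → ℕ) →
                  (∀ i j a b → Arc P i j a b → rank i j a ℕ.< rank i j b) → Acyclic P
acyclic-by-rank P rank increasing i j _ a cycle =
  ℕₚ.<-irrefl refl (TransClosure-rank-< (rank i j) (increasing i j _ _) cycle)

Arc? : ∀ {n d} (P : System n d) i j a b → Dec (Arc P i j a b)
Arc? P i j a b = ¬? (a Finₚ.≟ b) ×-dec Before? (perm P a b) i j

-- For an acyclic system each Arc P i j (i ≢ j) is a transitive tournament,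
-- whose in-degrees increase along every arc.
inDegree : ∀ {n d} → System n d → Fin n → Fin n → Fin d → ℕ
inDegree {d = d} P i j b = length (filter (λ a → Arc? P i j a b) (allFin d))

permutationOf : ∀ {n} (positions order : Vec (Fin n) n) →
                {True (Finₚ.all? λ y → lookup positions (lookup order y) Finₚ.≟ y)} →
                {True (Finₚ.all? λ x → lookup order (lookup positions x) Finₚ.≟ x)} → Permutation′ n
permutationOf positions order {p} {q} =
  permutation (lookup positions) (lookup order) (toWitness p) (toWitness q)

edgePermutation : Fin 4 → Fin 4 → Permutation′ 5
edgePermutation 0F 1F = permutationOf (1F ∷ 3F ∷ 4F ∷ 2F ∷ 0F ∷ []) (4F ∷ 0F ∷ 3F ∷ 1F ∷ 2F ∷ [])
edgePermutation 0F 2F = permutationOf (2F ∷ 1F ∷ 3F ∷ 4F ∷ 0F ∷ []) (4F ∷ 1F ∷ 0F ∷ 2F ∷ 3F ∷ [])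
edgePermutation 0F 3F = permutationOf (2F ∷ 0F ∷ 4F ∷ 3F ∷ 1F ∷ []) (1F ∷ 4F ∷ 0F ∷ 3F ∷ 2F ∷ [])
edgePermutation 1F 2F = permutationOf (3F ∷ 1F ∷ 0F ∷ 2F ∷ 4F ∷ []) (2F ∷ 1F ∷ 3F ∷ 0F ∷ 4F ∷ [])
edgePermutation 1F 3F = permutationOf (3F ∷ 0F ∷ 2F ∷ 1F ∷ 4F ∷ []) (1F ∷ 3F ∷ 2F ∷ 0F ∷ 4F ∷ [])
edgePermutation 2F 3F = permutationOf (4F ∷ 0F ∷ 3F ∷ 1F ∷ 2F ∷ []) (1F ∷ 3F ∷ 4F ∷ 2F ∷ 0F ∷ [])
edgePermutation _  _  = id

system : System 5 4
system = orientedSystem edgePermutation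

system-acyclic : Acyclic system
system-acyclic = acyclic-by-rank system (inDegree system) (from-yes
  (Finₚ.all? λ i → Finₚ.all? λ j → Finₚ.all? λ a → Finₚ.all? λ b →
     Arc? system i j a b →-dec (inDegree system i j a ℕ.<? inDegree system i j b)))

p-x q-x : Fin 5 → ℚ
p-x = lookup ((+ 1 / 14) ∷ (+ 1 / 2) ∷ (+ 3 / 7) ∷ 0ℚ ∷ 0ℚ ∷ [])
q-x = lookup ((+ 1 / 3) ∷ (+ 1 / 12) ∷ (+ 1 / 12) ∷ (+ 1 / 2) ∷ 0ℚ ∷ [])

p-y q-y : Fin 4 → ℚ
p-y = lookup ((+ 1 / 13) ∷ (+ 7 / 13) ∷ (+ 1 / 13) ∷ (+ 4 / 13) ∷ [])
q-y = lookup ((+ 1 / 11) ∷ (+ 2 / 11) ∷ 0ℚ ∷ (+ 8 / 11) ∷ [])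

triangle-p triangle-q : List (Fin 5 × Fin 4)
triangle-p = (0F , 3F) ∷ (1F , 0F) ∷ (2F , 1F) ∷ []
triangle-q = (0F , 0F) ∷ (1F , 1F) ∷ (2F , 3F) ∷ []

module _ {T : List (VSet 5 4)} (induces : Induces T system) {S : VSet 5 4} (S∈T : S ∈ T) where

  excluded : ∀ {i a j b} → S i a ≡ true →
             {_ : False (a Finₚ.≟ b)} {_ : False (i Finₚ.≟ j)} {_ : False (Before? (perm system a b) i j)} →
             S j b ≡ false
  excluded {i} {a} {j} {b} Sia {a≢b} {i≢j} {¬before} =
    induced-exclusion {T = T} {P = system} induces S∈T Sia (toWitnessFalse {a? = a Finₚ.≟ b} a≢b)
      (toWitnessFalse {a? = i Finₚ.≟ j} i≢j) (toWitnessFalse {a? = Before? (perm system a b) i j} ¬before)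

  simplex-at-p : InConv S p-x p-y → All (λ (i , a) → S i a ≡ true) triangle-p
  simplex-at-p p∈S = in₀₃ ∷ in₁₀ ∷ in₂₁ ∷ []
    where
    in₁₁ : S 1F 1F ≡ true
    in₁₁ = forcedInRow p∈S []
    out₂₀ : S 2F 0F ≡ false
    out₂₀ = excluded in₁₁
    out₂₂ : S 2F 2F ≡ false
    out₂₂ = excluded in₁₁
    in₁₀ : S 1F 0F ≡ true
    in₁₀ = forcedInColumn p∈S (out₂₀ ∷ [])
    out₀₁ : S 0F 1F ≡ false
    out₀₁ = excluded in₁₀
    out₄₂ : S 4F 2F ≡ false
    out₄₂ = excluded in₁₀
    in₁₂ : S 1F 2F ≡ true
    in₁₂ = forcedInColumn p∈S (out₂₂ ∷ out₄₂ ∷ [])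
    out₀₀ : S 0F 0F ≡ false
    out₀₀ = excluded in₁₂
    in₂₁ : S 2F 1F ≡ true
    in₂₁ = forcedInRow p∈S (out₂₀ ∷ out₂₂ ∷ [])
    out₁₃ : S 1F 3F ≡ false
    out₁₃ = excluded in₂₁
    out₃₃ : S 3F 3F ≡ false
    out₃₃ = excluded in₂₁
    in₂₃ : S 2F 3F ≡ true
    in₂₃ = forcedInColumn p∈S (out₁₃ ∷ out₃₃ ∷ [])
    out₀₂ : S 0F 2F ≡ false
    out₀₂ = excluded in₂₃
    in₀₃ : S 0F 3F ≡ true
    in₀₃ = forcedInRow p∈S (out₀₀ ∷ out₀₁ ∷ out₀₂ ∷ [])

  simplex-at-q : InConv S q-x q-y → All (λ (i , a) → S i a ≡ true) triangle-q
  simplex-at-q q∈S = in₀₀ ∷ in₁₁ ∷ in₂₃ ∷ []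
    where
    in₀₃ : S 0F 3F ≡ true
    in₀₃ = forcedInRow q∈S []
    out₂₀ : S 2F 0F ≡ false
    out₂₀ = excluded in₀₃
    out₃₀ : S 3F 0F ≡ false
    out₃₀ = excluded in₀₃
    out₄₁ : S 4F 1F ≡ false
    out₄₁ = excluded in₀₃
    in₀₀ : S 0F 0F ≡ true
    in₀₀ = forcedInColumn q∈S (out₂₀ ∷ out₃₀ ∷ [])
    out₁₂ : S 1F 2F ≡ false
    out₁₂ = excluded in₀₀
    out₁₃ : S 1F 3F ≡ false
    out₁₃ = excluded in₀₀
    in₃₃ : S 3F 3F ≡ true
    in₃₃ = forcedInRow q∈S (out₃₀ ∷ [])
    out₀₁ : S 0F 1F ≡ false
    out₀₁ = excluded in₃₃
    out₂₁ : S 2F 1F ≡ false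
    out₂₁ = excluded in₃₃
    out₂₂ : S 2F 2F ≡ false
    out₂₂ = excluded in₃₃
    in₂₃ : S 2F 3F ≡ true
    in₂₃ = forcedInRow q∈S (out₂₀ ∷ out₂₁ ∷ out₂₂ ∷ [])
    in₃₁ : S 3F 1F ≡ true
    in₃₁ = forcedInColumn q∈S (out₀₁ ∷ out₂₁ ∷ out₄₁ ∷ [])
    out₁₀ : S 1F 0F ≡ false
    out₁₀ = excluded in₃₁
    in₁₁ : S 1F 1F ≡ true
    in₁₁ = forcedInRow q∈S (out₁₀ ∷ out₁₂ ∷ out₁₃ ∷ [])

⅓ : ℚ
⅓ = + 1 / 3

centre-x : Fin 5 → ℚ
centre-x = lookup (⅓ ∷ ⅓ ∷ ⅓ ∷ 0ℚ ∷ 0ℚ ∷ [])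

centre-y : Fin 4 → ℚ
centre-y = lookup (⅓ ∷ ⅓ ∷ 0ℚ ∷ ⅓ ∷ [])

uniformOn : VSet 5 4 → Fin 5 → Fin 4 → ℚ
uniformOn t i a = if t i a then ⅓ else 0ℚ

centre∈ : ∀ vs →
  {True (sumFin 5 (λ i → sumFin 4 (uniformOn (vertices vs) i)) ℚₚ.≟ 1ℚ)} →
  {True (Finₚ.all? λ i → sumFin 4 (uniformOn (vertices vs) i) ℚₚ.≟ centre-x i)} →
  {True (Finₚ.all? λ a → sumFin 5 (λ i → uniformOn (vertices vs) i a) ℚₚ.≟ centre-y a)} →
  InConv (vertices vs) centre-x centre-y
centre∈ vs {total} {rows} {cols} =
  uniformOn t , nonneg , supported , toWitness total , toWitness rows , toWitness cols
  where
  t : VSet 5 4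
  t = vertices vs
  nonneg : ∀ i a → 0ℚ ≤ uniformOn t i a
  nonneg i a with t i a
  ... | true  = from-yes (0ℚ ℚₚ.≤? ⅓)
  ... | false = ℚₚ.≤-refl
  supported : ∀ i a → t i a ≡ false → uniformOn t i a ≡ 0ℚ
  supported i a tia = cong (if_then ⅓ else 0ℚ) tia

no-inducing-triangulation : ¬ (Σ (List (VSet 5 4)) λ T → IsTriangulation T × Induces T system)
no-inducing-triangulation (T , isT@(_ , covers , _) , induces)
  with covers p-x p-y (from-yes (InPolytope? p-x p-y)) | covers q-x q-y (from-yes (InPolytope? q-x q-y))
... | Sp , Sp∈T , p∈Sp | Sq , Sq∈T , q∈Sq =
  ⅓≢0 (triangulation-coefficients-agree isT Sp∈T Sq∈T centre∈Sp centre∈Sq 0F 3F)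
  where
  centre∈Sp : InConv Sp centre-x centre-y
  centre∈Sp = InConv-mono (vertices-⊆ (simplex-at-p induces Sp∈T p∈Sp)) (centre∈ triangle-p)
  centre∈Sq : InConv Sq centre-x centre-y
  centre∈Sq = InConv-mono (vertices-⊆ (simplex-at-q induces Sq∈T q∈Sq)) (centre∈ triangle-q)
  ⅓≢0 : ⅓ ≢ 0ℚ
  ⅓≢0 ()

mainTheorem2 : Σ (System 5 4) λ P →
    Acyclic P × ¬ (Σ (List (VSet 5 4)) λ T → IsTriangulation T × Induces T P)
mainTheorem2 = system , system-acyclic , no-inducing-triangulation
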